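{- Let $G$ be a strong tricentral $2$-tree with tail set $\{2,3\}$ on $n\ge 4$ vertices with maximum degree $\Delta$. Then $\left\lceil \frac{n+5}{3}\right\rceil\le\Delta\le\min\left\{\left\lfloor\frac{2n}{3}\right\rfloor,\,n-1\right\}$, and the numbers $x,y$ of tail vertices of degree $3$ and $2$ are given by $x=2n-3\Delta$ and $y=3\Delta-n-3$.
   Context: A $2$-tree is a graph obtained from the triangle $K_3$ by repeatedly adding a new vertex adjacent to both endpoints of an existing edge. For $r\in\{1,2,3\}$ and an integer $\Delta\ge 2$, a $2$-tree on $n$ vertices is $r$-central with maximum degree $\Delta$ if $\Delta$ is its maximum degree and exactly $r$ vertices have degree $\Delta$; these $r$ vertices form the core and the other $n-r$ vertices form the tail. It is strong if the core induces $K_r$. It has tail set $\{2,3\}$ if every tail vertex has degree $2$ or $3$. "Tricentral" means $3$-central. -}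

module Defs where

open import Data.Bool using (Bool; true; false; _∨_; _∧_; not; if_then_else_)
open import Data.Nat using (ℕ; zero; suc; _+_; _*_; _≤_; _/_; _≡ᵇ_)
open import Data.Fin using (Fin; zero; suc)
open import Data.Fin.Permutation using (Permutation′; _⟨$⟩ʳ_)
open import Data.Product using (Σ; _×_; _,_; ∃)
open import Data.Sum using (_⊎_)
open import Relation.Binary.PropositionalEquality using (_≡_; _≢_)
open import Relation.Nullary using (¬_)

_==_ : ∀ {n} → Fin n → Fin n → Bool
zero  == zero  = true
zero  == suc _ = false
suc _ == zero  = false
suc i == suc j = i == j

Graph : ℕ → Set
Graph n = Fin n → Fin n → Bool

K3 : Graph 3
K3 i j = not (i == j)

-- Add a new vertex (index zero, old vertices shifted by suc) adjacent to
-- exactly the two endpoints u, v of an existing edge.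
extend : ∀ {n} → Graph n → Fin n → Fin n → Graph (suc n)
extend G u v zero    zero    = false
extend G u v zero    (suc j) = (j == u) ∨ (j == v)
extend G u v (suc i) zero    = (i == u) ∨ (i == v)
extend G u v (suc i) (suc j) = G i j

relabel : ∀ {n} → Permutation′ n → Graph n → Graph n
relabel σ G i j = G (σ ⟨$⟩ʳ i) (σ ⟨$⟩ʳ j)

data IsTwoTree : (n : ℕ) → Graph n → Set where
  triangle : IsTwoTree 3 K3
  step     : ∀ {n} {G : Graph n} → IsTwoTree n G → (u v : Fin n) →
             G u v ≡ true → IsTwoTree (suc n) (extend G u v)
  iso      : ∀ {n} {G : Graph n} → IsTwoTree n G → (σ : Permutation′ n) →
             IsTwoTree n (relabel σ G)

countFin : (n : ℕ) → (Fin n → Bool) → ℕ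
countFin zero    P = 0
countFin (suc n) P = (if P zero then 1 else 0) + countFin n (λ i → P (suc i))

degree : ∀ {n} → Graph n → Fin n → ℕ
degree {n} G v = countFin n (G v)

IsMaxDegree : ∀ {n} → Graph n → ℕ → Set
IsMaxDegree G Δ = (∀ v → degree G v ≤ Δ) × ∃ (λ v → degree G v ≡ Δ)

-- Core: vertices of degree Δ; tail: the others.
inCore : ∀ {n} → Graph n → ℕ → Fin n → Bool
inCore G Δ v = degree G v ≡ᵇ Δ

IsCentral : ∀ {n} → ℕ → Graph n → ℕ → Set
IsCentral {n} r G Δ = 2 ≤ Δ × IsMaxDegree G Δ × countFin n (inCore G Δ) ≡ r

CoreComplete : ∀ {n} → Graph n → ℕ → Set
CoreComplete G Δ = ∀ u v → degree G u ≡ Δ → degree G v ≡ Δ → u ≢ v → G u v ≡ true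

TailSet23 : ∀ {n} → Graph n → ℕ → Set
TailSet23 G Δ = ∀ v → degree G v ≢ Δ → (degree G v ≡ 2 ⊎ degree G v ≡ 3)

tailCount : ∀ {n} → Graph n → ℕ → ℕ → ℕ
tailCount {n} G Δ k = countFin n (λ v → not (degree G v ≡ᵇ Δ) ∧ (degree G v ≡ᵇ k))

⌈_/3⌉ : ℕ → ℕ
⌈ a /3⌉ = (a + 2) / 3

⌊_/3⌋ : ℕ → ℕ
⌊ a /3⌋ = a / 3

{-# OPTIONS --safe #-}
-- A 2-tree on n vertices has 2n - 3 edges, so its degrees sum to 4n - 6.  With three core
-- vertices of degree Δ and x, y tail vertices of degree 3, 2 this gives n = 3 + x + y and
-- 3Δ + 3x + 2y = 4n - 6, i.e. x + 3Δ = 2n and y + 3 + n = 3Δ; these are the formulas for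
-- x and y, and x ≥ 0 gives the upper bound.  For the lower bound, n ≥ 4 forces Δ ≥ 3, so the
-- two degree-2 vertices that every 2-tree has lie in the tail: y ≥ 2, whence 3Δ ≥ n + 5.
module Submission where

open import Defs
open import Data.Nat using (ℕ; _+_; _*_; _∸_; _≤_; _⊓_)
open import Data.Integer using (ℤ; +_; _-_)
open import Data.Product using (_×_)
open import Relation.Binary.PropositionalEquality using (_≡_)

open import Data.Bool using (Bool; true; false; _∨_; _∧_; not; if_then_else_; T)
open import Data.Bool.Properties using (∨-identityʳ; T-≡)
open import Data.Fin using (Fin; zero; suc)
open import Data.Fin.Permutation using (Permutation′; _⟨$⟩ʳ_; _⟨$⟩ˡ_; inverseʳ)
open import Data.Integer using (_⊖_)
open import Data.Integer.Properties using ([+m]-[+n]≡m⊖n; ⊖-≥)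
open import Data.List using (_∷_; [])
open import Data.Nat using (zero; suc; _<_; _≡ᵇ_; _/_; z≤n; s≤s; s≤s⁻¹; z<s)
open import Data.Nat.DivMod using (m<n*o⇒m/o<n; m*n/n≡m; /-monoˡ-≤)
open import Data.Nat.Properties
open import Algebra.Properties.Semiring.Sum +-*-semiring
  using (sum-syntax; sum-cong-≗; sum-permute; ∑-distrib-+; *-distribʳ-sum)
open import Data.Nat.Tactic.RingSolver using (solve)
open import Data.Product using (∃; ∃₂; _,_; proj₁; proj₂; uncurry)
open import Data.Sum using (_⊎_; inj₁; inj₂)
open import Function using (_∘_; Equivalence)
open import Relation.Binary.PropositionalEquality
  using (_≢_; refl; sym; trans; cong; cong₂; subst; module ≡-Reasoning)
open import Relation.Nullary using (contradiction)

⌈/3⌉≤ : ∀ {m k} → m ≤ 3 * k → ⌈ m /3⌉ ≤ k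
⌈/3⌉≤ {m} {k} m≤3k = s≤s⁻¹ (m<n*o⇒m/o<n (begin-strict
  m + 2         <⟨ s≤s ≤-refl ⟩
  suc (m + 2)   ≡⟨ +-suc m 2 ⟨
  m + 3         ≤⟨ +-monoˡ-≤ 3 m≤3k ⟩
  3 * k + 3     ≡⟨ solve (k ∷ []) ⟩
  suc k * 3     ∎))
  where open ≤-Reasoning

≤⌊/3⌋ : ∀ {m k} → 3 * k ≤ m → k ≤ ⌊ m /3⌋
≤⌊/3⌋ {m} {k} 3k≤m = begin
  k          ≡⟨ m*n/n≡m k 3 ⟨
  k * 3 / 3  ≤⟨ /-monoˡ-≤ 3 (subst (_≤ m) (*-comm 3 k) 3k≤m) ⟩
  m / 3      ∎
  where open ≤-Reasoning

m+n≡o⇒+m≡+o-+n : ∀ {m n o} → m + n ≡ o → + m ≡ + o - + n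
m+n≡o⇒+m≡+o-+n {m} {n} refl = sym (begin
  + (m + n) - + n   ≡⟨ [+m]-[+n]≡m⊖n (m + n) n ⟩
  (m + n) ⊖ n       ≡⟨ ⊖-≥ (m≤n+m n m) ⟩
  + (m + n ∸ n)     ≡⟨ cong +_ (m+n∸n≡m m n) ⟩
  + m               ∎)
  where open ≡-Reasoning

𝟙 : Bool → ℕ
𝟙 b = if b then 1 else 0

countFin≡∑𝟙 : ∀ n (P : Fin n → Bool) → countFin n P ≡ ∑[ i < n ] 𝟙 (P i)
countFin≡∑𝟙 zero    P = refl
countFin≡∑𝟙 (suc n) P = cong (_+_ (𝟙 (P zero))) (countFin≡∑𝟙 n (P ∘ suc))

∑-𝟙*≡countFin* : ∀ n (P : Fin n → Bool) w → ∑[ i < n ] (𝟙 (P i) * w) ≡ countFin n P * w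
∑-𝟙*≡countFin* n P w = begin
  ∑[ i < n ] (𝟙 (P i) * w)  ≡⟨ *-distribʳ-sum w (𝟙 ∘ P) ⟨
  (∑[ i < n ] 𝟙 (P i)) * w  ≡⟨ cong (_* w) (countFin≡∑𝟙 n P) ⟨
  countFin n P * w          ∎
  where open ≡-Reasoning

∑-const : ∀ n c → ∑[ i < n ] c ≡ n * c
∑-const zero    c = refl
∑-const (suc n) c = cong (_+_ c) (∑-const n c)

countFin-cong : ∀ n {P Q : Fin n → Bool} → (∀ i → P i ≡ Q i) → countFin n P ≡ countFin n Q
countFin-cong zero    P≗Q = refl
countFin-cong (suc n) P≗Q = cong₂ _+_ (cong 𝟙 (P≗Q zero)) (countFin-cong n (P≗Q ∘ suc))

countFin-false : ∀ n → countFin n (λ _ → false) ≡ 0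
countFin-false zero    = refl
countFin-false (suc n) = countFin-false n

countFin-permute : ∀ n (σ : Permutation′ n) (P : Fin n → Bool) →
                   countFin n (P ∘ (σ ⟨$⟩ʳ_)) ≡ countFin n P
countFin-permute n σ P = begin
  countFin n (P ∘ (σ ⟨$⟩ʳ_))      ≡⟨ countFin≡∑𝟙 n _ ⟩
  ∑[ i < n ] 𝟙 (P (σ ⟨$⟩ʳ i))     ≡⟨ sum-permute (𝟙 ∘ P) σ ⟨
  ∑[ i < n ] 𝟙 (P i)              ≡⟨ countFin≡∑𝟙 n P ⟨
  countFin n P                    ∎
  where open ≡-Reasoning

countFin-witness : ∀ n (P : Fin n → Bool) → 0 < countFin n P → ∃ λ i → P i ≡ true
countFin-witness (suc n) P pos with P zero in P0
... | true  = zero , P0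
... | false with countFin-witness n (P ∘ suc) pos
...   | i , Pi = suc i , Pi

1≤countFin : ∀ {n} (P : Fin n → Bool) {a} → P a ≡ true → 1 ≤ countFin n P
1≤countFin P {zero}  Pa rewrite Pa = s≤s z≤n
1≤countFin P {suc a} Pa = ≤-trans (1≤countFin (P ∘ suc) Pa) (m≤n+m _ (𝟙 (P zero)))

2≤countFin : ∀ {n} (P : Fin n → Bool) {a b} → a ≢ b → P a ≡ true → P b ≡ true →
             2 ≤ countFin n P
2≤countFin P {zero}  {zero}  a≢b Pa Pb = contradiction refl a≢b
2≤countFin P {zero}  {suc b} a≢b Pa Pb rewrite Pa = s≤s (1≤countFin (P ∘ suc) Pb)
2≤countFin P {suc a} {zero}  a≢b Pa Pb rewrite Pb = s≤s (1≤countFin (P ∘ suc) Pa)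
2≤countFin P {suc a} {suc b} a≢b Pa Pb =
  ≤-trans (2≤countFin (P ∘ suc) (a≢b ∘ cong suc) Pa Pb) (m≤n+m _ (𝟙 (P zero)))

≢⇒==-false : ∀ {n} {i j : Fin n} → i ≢ j → (i == j) ≡ false
≢⇒==-false {i = zero}  {zero}  i≢j = contradiction refl i≢j
≢⇒==-false {i = zero}  {suc j} i≢j = refl
≢⇒==-false {i = suc i} {zero}  i≢j = refl
≢⇒==-false {i = suc i} {suc j} i≢j = ≢⇒==-false (i≢j ∘ cong suc)

countFin-== : ∀ n (u : Fin n) → countFin n (_== u) ≡ 1
countFin-== (suc n) zero    = cong suc (countFin-false n)
countFin-== (suc n) (suc u) = countFin-== n u

countFin-==-∨ : ∀ n {u v : Fin n} → u ≢ v → countFin n (λ j → (j == u) ∨ (j == v)) ≡ 2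
countFin-==-∨ (suc n) {zero}  {zero}  u≢v = contradiction refl u≢v
countFin-==-∨ (suc n) {zero}  {suc v} u≢v = cong suc (countFin-== n v)
countFin-==-∨ (suc n) {suc u} {zero}  u≢v =
  cong suc (trans (countFin-cong n (λ j → ∨-identityʳ (j == u))) (countFin-== n u))
countFin-==-∨ (suc n) {suc u} {suc v} u≢v = countFin-==-∨ n (u≢v ∘ cong suc)

degree-relabel : ∀ {n} (σ : Permutation′ n) (G : Graph n) v →
                 degree (relabel σ G) v ≡ degree G (σ ⟨$⟩ʳ v)
degree-relabel {n} σ G v = countFin-permute n σ (G (σ ⟨$⟩ʳ v))

-- The last field is the inductive form of "a 2-tree has two degree-2 vertices":
-- when a vertex is attached to an edge uv, it serves every old edge, while the
-- old witness off uv serves the two new edges.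
record TwoTreeInvariants {n} (G : Graph n) : Set where
  field
    loopless       : ∀ v → G v v ≡ false
    degree-sum     : ∑[ v < n ] degree G v + 6 ≡ 4 * n
    degree-two     : ∃ λ c → degree G c ≡ 2
    degree-two-off : ∀ {u v} → G u v ≡ true → ∃ λ c → degree G c ≡ 2 × c ≢ u × c ≢ v

open TwoTreeInvariants

K3-invariants : TwoTreeInvariants K3
K3-invariants = record
  { loopless       = λ { zero → refl ; (suc zero) → refl ; (suc (suc zero)) → refl }
  ; degree-sum     = refl
  ; degree-two     = zero , refl
  ; degree-two-off = off-edge
  }
  where
  off-edge : ∀ {u v} → K3 u v ≡ true → ∃ λ c → degree K3 c ≡ 2 × c ≢ u × c ≢ v
  off-edge {zero}           {suc zero}       _ = suc (suc zero) , refl , (λ ()) , (λ ())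
  off-edge {zero}           {suc (suc zero)} _ = suc zero , refl , (λ ()) , (λ ())
  off-edge {suc zero}       {zero}           _ = suc (suc zero) , refl , (λ ()) , (λ ())
  off-edge {suc zero}       {suc (suc zero)} _ = zero , refl , (λ ()) , (λ ())
  off-edge {suc (suc zero)} {zero}           _ = suc zero , refl , (λ ()) , (λ ())
  off-edge {suc (suc zero)} {suc zero}       _ = zero , refl , (λ ()) , (λ ())
  off-edge {zero}           {zero}           ()
  off-edge {suc zero}       {suc zero}       ()
  off-edge {suc (suc zero)} {suc (suc zero)} ()

extend-invariants : ∀ {n} {G : Graph n} {u v} → TwoTreeInvariants G → G u v ≡ true →
                    TwoTreeInvariants (extend G u v)
extend-invariants {n} {G} {u} {v} I uv = record
  { loopless       = λ { zero → refl ; (suc i) → loopless I i }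
  ; degree-sum     = degree-sum′
  ; degree-two     = zero , degree-new
  ; degree-two-off = off-edge
  }
  where
  H : Graph (suc n)
  H = extend G u v

  u≢v : u ≢ v
  u≢v refl with trans (sym (loopless I u)) uv
  ... | ()

  degree-new : degree H zero ≡ 2
  degree-new = countFin-==-∨ n u≢v

  degree-sum′ : ∑[ w < suc n ] degree H w + 6 ≡ 4 * suc n
  degree-sum′ = begin
    degree H zero + ∑[ i < n ] (𝟙 ((i == u) ∨ (i == v)) + degree G i) + 6
      ≡⟨ cong₂ (λ d s → d + s + 6) degree-new (∑-distrib-+ _ (degree G)) ⟩
    2 + (∑[ i < n ] 𝟙 ((i == u) ∨ (i == v)) + ∑[ i < n ] degree G i) + 6
      ≡⟨ cong (λ s → 2 + (s + ∑[ i < n ] degree G i) + 6)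
              (trans (sym (countFin≡∑𝟙 n _)) degree-new) ⟩
    4 + (∑[ i < n ] degree G i + 6)
      ≡⟨ cong (_+_ 4) (degree-sum I) ⟩
    4 + 4 * n
      ≡⟨ *-suc 4 n ⟨
    4 * suc n ∎
    where open ≡-Reasoning

  off-new-edge : ∀ {j} → (j == u) ∨ (j == v) ≡ true →
         ∃ λ c → degree H c ≡ 2 × c ≢ zero × c ≢ suc j
  off-new-edge j∈uv with degree-two-off I uv
  ... | c , dc , c≢u , c≢v = suc c , trans (cong (λ b → 𝟙 b + degree G c) c∉uv) dc , (λ ()) , c≢j
    where
    c∉uv : (c == u) ∨ (c == v) ≡ false
    c∉uv = cong₂ _∨_ (≢⇒==-false c≢u) (≢⇒==-false c≢v)
    c≢j : suc c ≢ suc _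
    c≢j refl with trans (sym c∉uv) j∈uv
    ... | ()

  off-edge : ∀ {a b} → H a b ≡ true → ∃ λ c → degree H c ≡ 2 × c ≢ a × c ≢ b
  off-edge {zero}  {zero}  ()
  off-edge {zero}  {suc j} j∈uv = off-new-edge j∈uv
  off-edge {suc i} {zero}  i∈uv with off-new-edge i∈uv
  ... | c , dc , c≢0 , c≢i = c , dc , c≢i , c≢0
  off-edge {suc i} {suc j} _    = zero , degree-new , (λ ()) , (λ ())

relabel-invariants : ∀ {n} {G : Graph n} (σ : Permutation′ n) → TwoTreeInvariants G →
                     TwoTreeInvariants (relabel σ G)
relabel-invariants {n} {G} σ I = record
  { loopless       = λ w → loopless I (σ ⟨$⟩ʳ w)
  ; degree-sum     = trans (cong (_+ 6) ∑-degree) (degree-sum I)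
  ; degree-two     = pull (degree-two I)
  ; degree-two-off = pull-off ∘ degree-two-off I
  }
  where
  degree-pull : ∀ c → degree (relabel σ G) (σ ⟨$⟩ˡ c) ≡ degree G c
  degree-pull c = trans (degree-relabel σ G _) (cong (degree G) (inverseʳ σ))

  ≢-pull : ∀ {c w} → c ≢ σ ⟨$⟩ʳ w → σ ⟨$⟩ˡ c ≢ w
  ≢-pull c≢σw refl = c≢σw (sym (inverseʳ σ))

  pull : (∃ λ c → degree G c ≡ 2) → ∃ λ c → degree (relabel σ G) c ≡ 2
  pull (c , dc) = σ ⟨$⟩ˡ c , trans (degree-pull c) dc

  pull-off : ∀ {a b} → (∃ λ c → degree G c ≡ 2 × c ≢ σ ⟨$⟩ʳ a × c ≢ σ ⟨$⟩ʳ b) →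
             ∃ λ c → degree (relabel σ G) c ≡ 2 × c ≢ a × c ≢ b
  pull-off (c , dc , c≢a , c≢b) = σ ⟨$⟩ˡ c , trans (degree-pull c) dc , ≢-pull c≢a , ≢-pull c≢b

  ∑-degree : ∑[ w < n ] degree (relabel σ G) w ≡ ∑[ w < n ] degree G w
  ∑-degree = trans (sum-cong-≗ (degree-relabel σ G)) (sym (sum-permute (degree G) σ))

twoTree-invariants : ∀ {n} {G : Graph n} → IsTwoTree n G → TwoTreeInvariants G
twoTree-invariants triangle         = K3-invariants
twoTree-invariants (step t u v uv)  = extend-invariants (twoTree-invariants t) uv
twoTree-invariants (iso t σ)        = relabel-invariants σ (twoTree-invariants t)

degree-two-pair : ∀ {n} {G : Graph n} → TwoTreeInvariants G →
                  ∃₂ λ a b → a ≢ b × degree G a ≡ 2 × degree G b ≡ 2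
degree-two-pair {n} {G} I with degree-two I
... | a , da with countFin-witness n (G a) (subst (0 <_) (sym da) z<s)
...   | w , aw with degree-two-off I aw
...     | b , db , b≢a , _ = a , b , b≢a ∘ sym , da , db

inTail : ∀ {n} → Graph n → ℕ → ℕ → Fin n → Bool
inTail G Δ k v = not (inCore G Δ v) ∧ (degree G v ≡ᵇ k)

degree-class-split : ∀ {d Δ} → (d ≢ Δ → d ≡ 2 ⊎ d ≡ 3) → (f : ℕ → ℕ) →
  f d ≡ 𝟙 (d ≡ᵇ Δ) * f Δ + 𝟙 (not (d ≡ᵇ Δ) ∧ (d ≡ᵇ 3)) * f 3 + 𝟙 (not (d ≡ᵇ Δ) ∧ (d ≡ᵇ 2)) * f 2
degree-class-split {d} {Δ} tail f with d ≡ᵇ Δ in d≡ᵇΔ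
... | true = trans (cong f (≡ᵇ⇒≡ d Δ (Equivalence.from T-≡ d≡ᵇΔ)))
                   (sym (trans (+-identityʳ _) (trans (+-identityʳ _) (+-identityʳ (f Δ)))))
... | false with tail (λ d≡Δ → subst T d≡ᵇΔ (≡⇒≡ᵇ d Δ d≡Δ))
...   | inj₁ refl = sym (+-identityʳ (f 2))
...   | inj₂ refl = sym (trans (+-identityʳ _) (+-identityʳ (f 3)))

∑-by-degree-class : ∀ {n} {G : Graph n} {Δ} → TailSet23 G Δ → (f : ℕ → ℕ) →
  ∑[ v < n ] f (degree G v) ≡
  countFin n (inCore G Δ) * f Δ + tailCount G Δ 3 * f 3 + tailCount G Δ 2 * f 2
∑-by-degree-class {n} {G} {Δ} tail f = begin
  ∑[ v < n ] f (degree G v)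
    ≡⟨ sum-cong-≗ (λ v → degree-class-split (tail v) f) ⟩
  ∑[ v < n ] (core v * f Δ + t3 v * f 3 + t2 v * f 2)
    ≡⟨ ∑-distrib-+ (λ v → core v * f Δ + t3 v * f 3) (λ v → t2 v * f 2) ⟩
  ∑[ v < n ] (core v * f Δ + t3 v * f 3) + ∑[ v < n ] (t2 v * f 2)
    ≡⟨ cong (_+ ∑[ v < n ] (t2 v * f 2)) (∑-distrib-+ (λ v → core v * f Δ) (λ v → t3 v * f 3)) ⟩
  ∑[ v < n ] (core v * f Δ) + ∑[ v < n ] (t3 v * f 3) + ∑[ v < n ] (t2 v * f 2)
    ≡⟨ cong₂ _+_ (cong₂ _+_ (∑-𝟙*≡countFin* n (inCore G Δ) (f Δ))
                             (∑-𝟙*≡countFin* n (inTail G Δ 3) (f 3)))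
                 (∑-𝟙*≡countFin* n (inTail G Δ 2) (f 2)) ⟩
  countFin n (inCore G Δ) * f Δ + tailCount G Δ 3 * f 3 + tailCount G Δ 2 * f 2 ∎
  where
  open ≡-Reasoning
  core t3 t2 : Fin n → ℕ
  core = 𝟙 ∘ inCore G Δ
  t3   = 𝟙 ∘ inTail G Δ 3
  t2   = 𝟙 ∘ inTail G Δ 2

tricentral-counts : ∀ {n} {G : Graph n} {Δ} → TwoTreeInvariants G → IsCentral 3 G Δ → TailSet23 G Δ →
  let x = tailCount G Δ 3 ; y = tailCount G Δ 2 in
  n ≡ 3 + x + y × 3 * Δ + x * 3 + y * 2 + 6 ≡ 4 * n
tricentral-counts {n} {G} {Δ} I (_ , _ , core≡3) tail = vertices , degrees
  where
  open ≡-Reasoning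
  x = tailCount G Δ 3
  y = tailCount G Δ 2
  vertices : n ≡ 3 + x + y
  vertices = begin
    n                                        ≡⟨ *-identityʳ n ⟨
    n * 1                                    ≡⟨ ∑-const n 1 ⟨
    ∑[ v < n ] 1                             ≡⟨ ∑-by-degree-class tail (λ _ → 1) ⟩
    countFin n (inCore G Δ) * 1 + x * 1 + y * 1
      ≡⟨ cong₂ (λ c a → c * 1 + a + y * 1) core≡3 (*-identityʳ x) ⟩
    3 + x + y * 1                            ≡⟨ cong (_+_ (3 + x)) (*-identityʳ y) ⟩
    3 + x + y                                ∎
  degrees : 3 * Δ + x * 3 + y * 2 + 6 ≡ 4 * n
  degrees = begin
    3 * Δ + x * 3 + y * 2 + 6
      ≡⟨ cong (λ c → c * Δ + x * 3 + y * 2 + 6) core≡3 ⟨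
    countFin n (inCore G Δ) * Δ + x * 3 + y * 2 + 6
      ≡⟨ cong (_+ 6) (∑-by-degree-class tail (λ d → d)) ⟨
    ∑[ v < n ] degree G v + 6
      ≡⟨ degree-sum I ⟩
    4 * n ∎

tricentral-equations : ∀ {n} Δ x y → n ≡ 3 + x + y → 3 * Δ + x * 3 + y * 2 + 6 ≡ 4 * n →
                       x + 3 * Δ ≡ 2 * n × y + 3 + n ≡ 3 * Δ
tricentral-equations Δ x y refl degrees =
  (begin
    x + 3 * Δ             ≡⟨ cong (_+_ x) 3Δ≡ ⟩
    x + (6 + x + y * 2)   ≡⟨ solve (x ∷ y ∷ []) ⟩
    2 * (3 + x + y)       ∎) ,
  (begin
    y + 3 + (3 + x + y)   ≡⟨ solve (x ∷ y ∷ []) ⟩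
    6 + x + y * 2         ≡⟨ 3Δ≡ ⟨
    3 * Δ                 ∎)
  where
  open ≡-Reasoning
  3Δ≡ : 3 * Δ ≡ 6 + x + y * 2
  3Δ≡ = +-cancelʳ-≡ (x * 3 + y * 2 + 6) (3 * Δ) (6 + x + y * 2) (begin
    3 * Δ + (x * 3 + y * 2 + 6)   ≡⟨ solve (Δ ∷ x ∷ y ∷ []) ⟩
    3 * Δ + x * 3 + y * 2 + 6     ≡⟨ degrees ⟩
    4 * (3 + x + y)               ≡⟨ solve (x ∷ y ∷ []) ⟩
    6 + x + y * 2 + (x * 3 + y * 2 + 6) ∎)

degree-two-in-tail : ∀ {d Δ} → d ≡ 2 → 3 ≤ Δ → not (d ≡ᵇ Δ) ∧ (d ≡ᵇ 2) ≡ true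
degree-two-in-tail refl (s≤s (s≤s (s≤s _))) = refl

2≤tailCount-2 : ∀ {n} {G : Graph n} {Δ} → TwoTreeInvariants G → 3 ≤ Δ → 2 ≤ tailCount G Δ 2
2≤tailCount-2 {G = G} {Δ} I 3≤Δ with degree-two-pair I
... | a , b , a≢b , da , db =
  2≤countFin (inTail G Δ 2) a≢b (degree-two-in-tail da 3≤Δ) (degree-two-in-tail db 3≤Δ)

3≤Δ : ∀ {n} Δ y → 4 ≤ n → y + 3 + n ≡ 3 * Δ → 3 ≤ Δ
3≤Δ Δ y 4≤n y+3+n≡3Δ =
  *-cancelˡ-< 3 2 Δ (subst (7 ≤_) y+3+n≡3Δ (+-mono-≤ (m≤n+m 3 y) 4≤n))

tricentral-bounds : ∀ {n} Δ x y → 1 ≤ n → 2 ≤ y → x + 3 * Δ ≡ 2 * n → y + 3 + n ≡ 3 * Δ →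
                    ⌈ n + 5 /3⌉ ≤ Δ × Δ ≤ ⌊ 2 * n /3⌋ ⊓ (n ∸ 1)
tricentral-bounds {n} Δ x y 1≤n 2≤y x+3Δ≡2n y+3+n≡3Δ =
  ⌈/3⌉≤ n+5≤3Δ , ⊓-glb (≤⌊/3⌋ 3Δ≤2n) (<⇒≤pred (*-cancelˡ-< 3 Δ n 3Δ<3n))
  where
  open ≤-Reasoning
  n+5≤3Δ : n + 5 ≤ 3 * Δ
  n+5≤3Δ = begin
    n + 5      ≡⟨ +-comm n 5 ⟩
    5 + n      ≤⟨ +-monoˡ-≤ n (+-monoˡ-≤ 3 2≤y) ⟩
    y + 3 + n  ≡⟨ y+3+n≡3Δ ⟩
    3 * Δ      ∎
  3Δ≤2n : 3 * Δ ≤ 2 * n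
  3Δ≤2n = subst (3 * Δ ≤_) x+3Δ≡2n (m≤n+m (3 * Δ) x)
  3Δ<3n : 3 * Δ < 3 * n
  3Δ<3n = ≤-<-trans 3Δ≤2n (m<n+m (2 * n) 1≤n)

corollary5p3 : (n Δ : ℕ) (G : Graph n) → IsTwoTree n G → 4 ≤ n →
    IsCentral 3 G Δ → CoreComplete G Δ → TailSet23 G Δ →
    (⌈ n + 5 /3⌉ ≤ Δ × Δ ≤ ⌊ 2 * n /3⌋ ⊓ (n ∸ 1)) ×
    (+ tailCount G Δ 3 ≡ + (2 * n) - + (3 * Δ)) ×
    (+ tailCount G Δ 2 ≡ + (3 * Δ) - + n - + 3)
corollary5p3 n Δ G t 4≤n central _ tail =
  tricentral-bounds Δ x y (≤-trans (s≤s z≤n) 4≤n) 2≤y x+3Δ≡2n y+3+n≡3Δ ,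
  m+n≡o⇒+m≡+o-+n x+3Δ≡2n ,
  trans (m+n≡o⇒+m≡+o-+n {n = 3} refl) (cong (_- + 3) (m+n≡o⇒+m≡+o-+n {m = y + 3} y+3+n≡3Δ))
  where
  x = tailCount G Δ 3
  y = tailCount G Δ 2
  I : TwoTreeInvariants G
  I = twoTree-invariants t
  equations : x + 3 * Δ ≡ 2 * n × y + 3 + n ≡ 3 * Δ
  equations = uncurry (tricentral-equations Δ x y) (tricentral-counts I central tail)
  x+3Δ≡2n : x + 3 * Δ ≡ 2 * n
  x+3Δ≡2n = proj₁ equations
  y+3+n≡3Δ : y + 3 + n ≡ 3 * Δ
  y+3+n≡3Δ = proj₂ equations
  2≤y : 2 ≤ y
  2≤y = 2≤tailCount-2 I (3≤Δ Δ y 4≤n y+3+n≡3Δ)
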